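{- Let $s\ge 2$ and $n_1,\ldots,n_s\ge 1$ be integers, $n=n_1+\cdots+n_s$, and let $K_{n_1,\ldots,n_s}$ be the complete $s$-partite graph with partition sets $X_1,\ldots,X_s$, $|X_i|=n_i$. Let $F$ be a spanning forest of $K_{n_1,\ldots,n_s}$ with components $T_1,\ldots,T_c$, and put $n_{ip}=|X_i\cap V(T_p)|$, $m_p=|V(T_p)|$, $\alpha_p=nm_p-\sum_{i=1}^s n_in_{ip}$. Let $N$ be the $s\times c$ matrix with $(i,p)$ entry $n_{ip}$. Then, with the vertices of $K_{n_1,\ldots,n_s}/F$ ordered as $T_1,\ldots,T_c$, $$L(K_{n_1,\ldots,n_s}/F)=\operatorname{diag}(\alpha_1,\ldots,\alpha_c)+N^{\top}(I_s-J_s)N,$$ where $J_s$ is the $s\times s$ all-ones matrix.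
   Context: For a graph $G$ (parallel edges allowed) and a spanning forest $F$ of $G$ with components $T_1,\ldots,T_c$, $G/F$ is the multigraph obtained by contracting all edges of $F$ and deleting loops: its vertices are $T_1,\ldots,T_c$, and $T_p$, $T_q$ ($p\ne q$) are joined by as many edges as there are edges of $G$ with one end in $V(T_p)$ and the other in $V(T_q)$. The Laplacian $L(G)$ of a multigraph has diagonal entry equal to the number of edges incident to the vertex and $(i,j)$ off-diagonal entry equal to minus the number of edges between $v_i$ and $v_j$. -}

module Defs where

open import Data.Nat as ℕ using (ℕ; zero; suc)
open import Data.Integer as ℤ using (ℤ; +_)
open import Data.Fin using (Fin; zero; suc; inject₁; fromℕ)
open import Data.Fin.Properties using (_≟_)
open import Data.Product using (Σ; ∃; _,_; proj₁)
open import Data.Bool using (Bool; true; false; if_then_else_; _∧_; not)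
open import Data.Empty using (⊥)
open import Relation.Nullary using (¬_)
open import Relation.Nullary.Decidable using (⌊_⌋)
open import Relation.Binary.PropositionalEquality using (_≡_)
open import Relation.Binary.Construct.Closure.ReflexiveTransitive using (Star)
open import Function.Definitions using (Injective)

∑ℕ : (k : ℕ) → (Fin k → ℕ) → ℕ
∑ℕ zero    f = 0
∑ℕ (suc k) f = f zero ℕ.+ ∑ℕ k (λ i → f (suc i))

∑ℤ : (k : ℕ) → (Fin k → ℤ) → ℤ
∑ℤ zero    f = + 0
∑ℤ (suc k) f = f zero ℤ.+ ∑ℤ k (λ i → f (suc i))

⟦_⟧ : Bool → ℕ
⟦ b ⟧ = if b then 1 else 0

-- Complete s-partite graph K_{n_1,...,n_s}
-- vertex (i , a) is the a-th vertex of the partition set X_i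

Vtx : (s : ℕ) (n : Fin s → ℕ) → Set
Vtx s n = Σ (Fin s) (λ i → Fin (n i))

Adj : {s : ℕ} {n : Fin s → ℕ} → Vtx s n → Vtx s n → Set
Adj u v = ¬ (proj₁ u ≡ proj₁ v)

adjᵇ : {s : ℕ} {n : Fin s → ℕ} → Vtx s n → Vtx s n → Bool
adjᵇ u v = not ⌊ proj₁ u ≟ proj₁ v ⌋

∑V : (s : ℕ) (n : Fin s → ℕ) → (Vtx s n → ℕ) → ℕ
∑V s n f = ∑ℕ s (λ i → ∑ℕ (n i) (λ a → f (i , a)))

-- a cycle of length 3 + k: distinct vertices f 0, ..., f (2+k),
-- consecutive ones adjacent, and f (2+k) adjacent to f 0
Acyclic : {V : Set} → (V → V → Set) → Set
Acyclic {V} E =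
  (k : ℕ) (f : Fin (3 ℕ.+ k) → V) → Injective _≡_ _≡_ f →
  ((i : Fin (2 ℕ.+ k)) → E (f (inject₁ i)) (f (suc i))) →
  E (f (fromℕ (2 ℕ.+ k))) (f zero) → ⊥

record SpanningForest (s : ℕ) (n : Fin s → ℕ) (F : Vtx s n → Vtx s n → Set) : Set where
  field
    symmetric : ∀ u v → F u v → F v u
    subgraph  : ∀ u v → F u v → Adj u v
    acyclic   : Acyclic F

-- the connected components of F, numbered T_0, ..., T_{c-1}:
-- comp v = p  means  v ∈ V(T_p)
record Components {V : Set} (E : V → V → Set) (c : ℕ) : Set where
  field
    comp     : V → Fin c
    nonempty : ∀ p → ∃ λ v → comp v ≡ p
    sound    : ∀ u v → comp u ≡ comp v → Star E u v
    complete : ∀ u v → Star E u v → comp u ≡ comp v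

-- Multigraphs on Fin k given by an edge-multiplicity function, and the
-- Laplacian: diagonal = number of incident edges, off-diagonal = minus
-- the number of edges between the two vertices.

Laplacian : (k : ℕ) → (Fin k → Fin k → ℕ) → Fin k → Fin k → ℤ
Laplacian k m p q =
  if ⌊ p ≟ q ⌋ then + ∑ℕ k (λ r → m p r) else ℤ.- (+ m p q)

-- G / F for G = K_{n_1,...,n_s}: vertices T_0..T_{c-1}; for p ≠ q the
-- number of edges of K with one end in V(T_p) and the other in V(T_q);
-- loops deleted (multiplicity 0 for p = q).
contractMult : (s : ℕ) (n : Fin s → ℕ) (c : ℕ) (comp : Vtx s n → Fin c) →
               Fin c → Fin c → ℕ
contractMult s n c comp p q =
  if ⌊ p ≟ q ⌋ then 0
  else ∑V s n (λ u → ∑V s n (λ v →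
         ⟦ ⌊ comp u ≟ p ⌋ ∧ ⌊ comp v ≟ q ⌋ ∧ adjᵇ u v ⟧))

Nmat : (s : ℕ) (n : Fin s → ℕ) (c : ℕ) (comp : Vtx s n → Fin c) →
       Fin s → Fin c → ℕ
Nmat s n c comp i p = ∑ℕ (n i) (λ a → ⟦ ⌊ comp (i , a) ≟ p ⌋ ⟧)

compSize : (s : ℕ) (n : Fin s → ℕ) (c : ℕ) (comp : Vtx s n → Fin c) → Fin c → ℕ
compSize s n c comp p = ∑V s n (λ v → ⟦ ⌊ comp v ≟ p ⌋ ⟧)

alpha : (s : ℕ) (n : Fin s → ℕ) (c : ℕ) (comp : Vtx s n → Fin c) → Fin c → ℤ
alpha s n c comp p =
  (+ (∑ℕ s n ℕ.* compSize s n c comp p))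
  ℤ.- (+ ∑ℕ s (λ i → n i ℕ.* Nmat s n c comp i p))

IminusJ : (s : ℕ) → Fin s → Fin s → ℤ
IminusJ s i j = (+ ⟦ ⌊ i ≟ j ⌋ ⟧) ℤ.- + 1

rhsMatrix : (s : ℕ) (n : Fin s → ℕ) (c : ℕ) (comp : Vtx s n → Fin c) →
            Fin c → Fin c → ℤ
rhsMatrix s n c comp p q =
  (if ⌊ p ≟ q ⌋ then alpha s n c comp p else + 0)
  ℤ.+ ∑ℤ s (λ i → ∑ℤ s (λ j →
        (+ Nmat s n c comp i p) ℤ.* IminusJ s i j ℤ.* (+ Nmat s n c comp j q)))

-- Let e(p,q) count the edges of K between T_p and T_q. Grouping vertices by their
-- part, e(p,q) = N_pᵀ A N_q for the adjacency matrix A = J − I of K_s, which gives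
-- the off-diagonal entries −e(p,q) = (Nᵀ(I − J)N)_pq. Every vertex lies in exactly
-- one T_r, so Σ_r n_ir = n_i and the degree of T_p is
--   Σ_{r≠p} e(p,r) = N_pᵀ A n − e(p,p) = (n m_p − Σ_i n_i n_ip) + (Nᵀ(I − J)N)_pp.
module Submission where

open import Defs
open import Data.Nat using (ℕ; _≤_)
open import Data.Integer using (ℤ)
open import Data.Fin using (Fin)
open import Relation.Binary.PropositionalEquality using (_≡_)

open import Data.Nat using (zero; suc; _+_; _*_)
open import Data.Nat.Properties
  using (+-identityʳ; *-identityʳ; *-zeroʳ; *-comm; *-distribˡ-+; +-*-semiring)
open import Data.Integer as ℤ using (+_; -_)
open import Data.Integer.Properties using (pos-+; pos-*; neg-distrib-+; +-identityˡ)
open import Data.Integer.Tactic.RingSolver using (solve-∀)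
open import Data.Fin using (zero; suc)
open import Data.Fin.Properties using (_≟_)
open import Data.Bool using (true; false; if_then_else_; _∧_; not)
open import Data.Product using (_,_)
open import Function using (_∘_)
open import Relation.Nullary using (yes; no)
open import Relation.Nullary.Decidable using (⌊_⌋; ⌊⌋-map′)
open import Relation.Binary.PropositionalEquality
  using (refl; sym; trans; cong; cong₂; module ≡-Reasoning)
open import Algebra.Properties.Semiring.Sum +-*-semiring
  using (sum; sum-cong-≗; ∑-distrib-+; ∑-comm; *-distribˡ-sum; *-distribʳ-sum)
open ≡-Reasoning

∑ℕ≡sum : ∀ {k} (f : Fin k → ℕ) → ∑ℕ k f ≡ sum f
∑ℕ≡sum {zero}  f = refl
∑ℕ≡sum {suc k} f = cong (_+_ (f zero)) (∑ℕ≡sum (f ∘ suc))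

∑ℕ-cong : ∀ k {f g : Fin k → ℕ} → (∀ i → f i ≡ g i) → ∑ℕ k f ≡ ∑ℕ k g
∑ℕ-cong k {f} {g} f≗g = trans (∑ℕ≡sum f) (trans (sum-cong-≗ f≗g) (sym (∑ℕ≡sum g)))

∑ℕ-distrib-+ : ∀ k (f g : Fin k → ℕ) →
               ∑ℕ k (λ i → f i + g i) ≡ ∑ℕ k f + ∑ℕ k g
∑ℕ-distrib-+ k f g = begin
  ∑ℕ k (λ i → f i + g i) ≡⟨ ∑ℕ≡sum (λ i → f i + g i) ⟩
  sum (λ i → f i + g i)  ≡⟨ ∑-distrib-+ f g ⟩
  sum f + sum g          ≡⟨ sym (cong₂ _+_ (∑ℕ≡sum f) (∑ℕ≡sum g)) ⟩
  ∑ℕ k f + ∑ℕ k g        ∎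

∑ℕ-comm : ∀ a b (f : Fin a → Fin b → ℕ) →
          ∑ℕ a (λ i → ∑ℕ b (f i)) ≡ ∑ℕ b (λ j → ∑ℕ a (λ i → f i j))
∑ℕ-comm a b f = begin
  ∑ℕ a (λ i → ∑ℕ b (f i))         ≡⟨ ∑ℕ₂≡sum₂ f ⟩
  sum (λ i → sum (f i))           ≡⟨ ∑-comm f ⟩
  sum (λ j → sum (λ i → f i j))   ≡⟨ sym (∑ℕ₂≡sum₂ (λ j i → f i j)) ⟩
  ∑ℕ b (λ j → ∑ℕ a (λ i → f i j)) ∎
  where
  ∑ℕ₂≡sum₂ : ∀ {a b} (g : Fin a → Fin b → ℕ) → ∑ℕ a (λ i → ∑ℕ b (g i)) ≡ sum (λ i → sum (g i))
  ∑ℕ₂≡sum₂ g = trans (∑ℕ≡sum (λ i → ∑ℕ _ (g i))) (sum-cong-≗ (λ i → ∑ℕ≡sum (g i)))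

*-distribˡ-∑ℕ : ∀ k x (f : Fin k → ℕ) → x * ∑ℕ k f ≡ ∑ℕ k (λ i → x * f i)
*-distribˡ-∑ℕ k x f =
  trans (cong (x *_) (∑ℕ≡sum f)) (trans (*-distribˡ-sum x f) (sym (∑ℕ≡sum (λ i → x * f i))))

*-distribʳ-∑ℕ : ∀ k x (f : Fin k → ℕ) → ∑ℕ k f * x ≡ ∑ℕ k (λ i → f i * x)
*-distribʳ-∑ℕ k x f =
  trans (cong (_* x) (∑ℕ≡sum f)) (trans (*-distribʳ-sum x f) (sym (∑ℕ≡sum (λ i → f i * x))))

∑ℕ-const : ∀ k x → ∑ℕ k (λ _ → x) ≡ k * x
∑ℕ-const zero    x = refl
∑ℕ-const (suc k) x = cong (_+_ x) (∑ℕ-const k x)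

∑ℕ-select : ∀ {k} (x : Fin k) (f : Fin k → ℕ) →
            ∑ℕ k (λ r → if ⌊ x ≟ r ⌋ then f r else 0) ≡ f x
∑ℕ-select {suc k} zero f =
  trans (cong (_+_ (f zero)) (trans (∑ℕ-const k 0) (*-zeroʳ k))) (+-identityʳ (f zero))
∑ℕ-select {suc k} (suc x) f =
  trans (∑ℕ-cong k (λ r → cong (λ b → if b then f (suc r) else 0) (⌊⌋-map′ _ _ (x ≟ r))))
        (∑ℕ-select x (f ∘ suc))

∑ℕ-punctured : ∀ {k} (x : Fin k) (f : Fin k → ℕ) →
               ∑ℕ k (λ r → if ⌊ x ≟ r ⌋ then 0 else f r) + f x ≡ ∑ℕ k f
∑ℕ-punctured {k} x f = begin
  ∑ℕ k (λ r → if ⌊ x ≟ r ⌋ then 0 else f r) + f x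
    ≡⟨ cong (_+_ _) (sym (∑ℕ-select x f)) ⟩
  ∑ℕ k (λ r → if ⌊ x ≟ r ⌋ then 0 else f r) + ∑ℕ k (λ r → if ⌊ x ≟ r ⌋ then f r else 0)
    ≡⟨ sym (∑ℕ-distrib-+ k _ _) ⟩
  ∑ℕ k (λ r → (if ⌊ x ≟ r ⌋ then 0 else f r) + (if ⌊ x ≟ r ⌋ then f r else 0))
    ≡⟨ ∑ℕ-cong k (λ r → split ⌊ x ≟ r ⌋ (f r)) ⟩
  ∑ℕ k f ∎
  where
  split : ∀ b y → (if b then 0 else y) + (if b then y else 0) ≡ y
  split true  y = refl
  split false y = +-identityʳ y

∑ℤ-cong : ∀ k {f g : Fin k → ℤ} → (∀ i → f i ≡ g i) → ∑ℤ k f ≡ ∑ℤ k g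
∑ℤ-cong zero    f≗g = refl
∑ℤ-cong (suc k) f≗g = cong₂ ℤ._+_ (f≗g zero) (∑ℤ-cong k (f≗g ∘ suc))

∑ℤ-neg : ∀ k (f : Fin k → ℕ) → ∑ℤ k (λ i → - (+ f i)) ≡ - (+ ∑ℕ k f)
∑ℤ-neg zero    f = refl
∑ℤ-neg (suc k) f = begin
  - (+ f zero) ℤ.+ ∑ℤ k (λ i → - (+ f (suc i))) ≡⟨ cong (ℤ._+_ (- (+ f zero))) (∑ℤ-neg k (f ∘ suc)) ⟩
  - (+ f zero) ℤ.+ - (+ ∑ℕ k (f ∘ suc))         ≡⟨ sym (neg-distrib-+ (+ f zero) _) ⟩
  - (+ f zero ℤ.+ + ∑ℕ k (f ∘ suc))             ≡⟨ cong -_ (sym (pos-+ (f zero) _)) ⟩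
  - (+ (f zero + ∑ℕ k (f ∘ suc)))               ∎

⟦∧⟧ : ∀ a b → ⟦ a ∧ b ⟧ ≡ ⟦ a ⟧ * ⟦ b ⟧
⟦∧⟧ true  b = sym (+-identityʳ ⟦ b ⟧)
⟦∧⟧ false b = refl

*-⟦not⟧ : ∀ y b → y * ⟦ not b ⟧ ≡ (if b then 0 else y)
*-⟦not⟧ y true  = *-zeroʳ y
*-⟦not⟧ y false = *-identityʳ y

adjacencyForm : ∀ {s} → (Fin s → ℕ) → (Fin s → ℕ) → ℕ
adjacencyForm {s} x y = ∑ℕ s (λ i → ∑ℕ s (λ j → x i * (y j * ⟦ not ⌊ i ≟ j ⌋ ⟧)))

adjacencyForm-+-dot : ∀ {s} (x y : Fin s → ℕ) →
  adjacencyForm x y + ∑ℕ s (λ i → x i * y i) ≡ ∑ℕ s x * ∑ℕ s y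
adjacencyForm-+-dot {s} x y = begin
  adjacencyForm x y + ∑ℕ s (λ i → x i * y i)
    ≡⟨ sym (∑ℕ-distrib-+ s _ _) ⟩
  ∑ℕ s (λ i → ∑ℕ s (λ j → x i * (y j * ⟦ not ⌊ i ≟ j ⌋ ⟧)) + x i * y i)
    ≡⟨ ∑ℕ-cong s (λ i → cong (_+ x i * y i) (sym (*-distribˡ-∑ℕ s (x i) _))) ⟩
  ∑ℕ s (λ i → x i * ∑ℕ s (λ j → y j * ⟦ not ⌊ i ≟ j ⌋ ⟧) + x i * y i)
    ≡⟨ ∑ℕ-cong s (λ i → cong (λ t → x i * t + x i * y i) (∑ℕ-cong s (λ j → *-⟦not⟧ (y j) _))) ⟩
  ∑ℕ s (λ i → x i * ∑ℕ s (λ j → if ⌊ i ≟ j ⌋ then 0 else y j) + x i * y i)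
    ≡⟨ ∑ℕ-cong s (λ i → sym (*-distribˡ-+ (x i) _ (y i))) ⟩
  ∑ℕ s (λ i → x i * (∑ℕ s (λ j → if ⌊ i ≟ j ⌋ then 0 else y j) + y i))
    ≡⟨ ∑ℕ-cong s (λ i → cong (x i *_) (∑ℕ-punctured i y)) ⟩
  ∑ℕ s (λ i → x i * ∑ℕ s y)
    ≡⟨ sym (*-distribʳ-∑ℕ s _ x) ⟩
  ∑ℕ s x * ∑ℕ s y ∎

∑-adjacencyFormʳ : ∀ {s c} (x : Fin s → ℕ) (y : Fin c → Fin s → ℕ) (z : Fin s → ℕ) →
  (∀ j → ∑ℕ c (λ r → y r j) ≡ z j) →
  ∑ℕ c (λ r → adjacencyForm x (y r)) ≡ adjacencyForm x z
∑-adjacencyFormʳ {s} {c} x y z ∑y≗z = begin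
  ∑ℕ c (λ r → ∑ℕ s (λ i → ∑ℕ s (λ j → x i * (y r j * A i j))))
    ≡⟨ ∑ℕ-comm c s _ ⟩
  ∑ℕ s (λ i → ∑ℕ c (λ r → ∑ℕ s (λ j → x i * (y r j * A i j))))
    ≡⟨ ∑ℕ-cong s (λ i → ∑ℕ-comm c s _) ⟩
  ∑ℕ s (λ i → ∑ℕ s (λ j → ∑ℕ c (λ r → x i * (y r j * A i j))))
    ≡⟨ ∑ℕ-cong s (λ i → ∑ℕ-cong s (λ j → sym (*-distribˡ-∑ℕ c (x i) _))) ⟩
  ∑ℕ s (λ i → ∑ℕ s (λ j → x i * ∑ℕ c (λ r → y r j * A i j)))
    ≡⟨ ∑ℕ-cong s (λ i → ∑ℕ-cong s (λ j → cong (x i *_) (sym (*-distribʳ-∑ℕ c (A i j) _)))) ⟩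
  ∑ℕ s (λ i → ∑ℕ s (λ j → x i * (∑ℕ c (λ r → y r j) * A i j)))
    ≡⟨ ∑ℕ-cong s (λ i → ∑ℕ-cong s (λ j → cong (λ t → x i * (t * A i j)) (∑y≗z j))) ⟩
  adjacencyForm x z ∎
  where
  A : Fin s → Fin s → ℕ
  A i j = ⟦ not ⌊ i ≟ j ⌋ ⟧

adjacencyForm-ℤ : ∀ {s} (x y : Fin s → ℕ) →
  ∑ℤ s (λ i → ∑ℤ s (λ j → + x i ℤ.* IminusJ s i j ℤ.* + y j)) ≡ - (+ adjacencyForm x y)
adjacencyForm-ℤ {s} x y =
  trans (∑ℤ-cong s (λ i → trans (∑ℤ-cong s (λ j → entry (x i) (y j) ⌊ i ≟ j ⌋)) (∑ℤ-neg s _)))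
        (∑ℤ-neg s _)
  where
  entry : ∀ a b d → + a ℤ.* (+ ⟦ d ⟧ ℤ.- + 1) ℤ.* + b ≡ - (+ (a * (b * ⟦ not d ⟧)))
  entry a b d = begin
    + a ℤ.* (+ ⟦ d ⟧ ℤ.- + 1) ℤ.* + b    ≡⟨ by-cases d ⟩
    - (+ a ℤ.* (+ b ℤ.* + ⟦ not d ⟧))    ≡⟨ cong -_ (sym (trans (pos-* a _) (cong (+ a ℤ.*_) (pos-* b _)))) ⟩
    - (+ (a * (b * ⟦ not d ⟧)))          ∎
    where
    by-cases : ∀ d → + a ℤ.* (+ ⟦ d ⟧ ℤ.- + 1) ℤ.* + b ≡ - (+ a ℤ.* (+ b ℤ.* + ⟦ not d ⟧))
    by-cases true  = on-diagonal (+ a) (+ b)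
      where
      on-diagonal : ∀ (A B : ℤ) → A ℤ.* (+ 1 ℤ.- + 1) ℤ.* B ≡ - (A ℤ.* (B ℤ.* + 0))
      on-diagonal = solve-∀
    by-cases false = off-diagonal (+ a) (+ b)
      where
      off-diagonal : ∀ (A B : ℤ) → A ℤ.* (+ 0 ℤ.- + 1) ℤ.* B ≡ - (A ℤ.* (B ℤ.* + 1))
      off-diagonal = solve-∀

∑V-cong : ∀ s n {f g : Vtx s n → ℕ} → (∀ u → f u ≡ g u) → ∑V s n f ≡ ∑V s n g
∑V-cong s n f≗g = ∑ℕ-cong s (λ i → ∑ℕ-cong (n i) (λ a → f≗g (i , a)))

∑V²-adjacencyForm : ∀ s n (f g : Vtx s n → ℕ) →
  ∑V s n (λ u → ∑V s n (λ v → f u * (g v * ⟦ adjᵇ u v ⟧)))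
  ≡ adjacencyForm (λ i → ∑ℕ (n i) (λ a → f (i , a))) (λ j → ∑ℕ (n j) (λ b → g (j , b)))
∑V²-adjacencyForm s n f g = begin
  ∑ℕ s (λ i → ∑ℕ (n i) (λ a → ∑ℕ s (λ j → ∑ℕ (n j) (λ b → f (i , a) * (g (j , b) * A i j)))))
    ≡⟨ ∑ℕ-cong s (λ i → ∑ℕ-cong (n i) (λ a → ∑ℕ-cong s (λ j → pull-out (f (i , a)) j (A i j)))) ⟩
  ∑ℕ s (λ i → ∑ℕ (n i) (λ a → ∑ℕ s (λ j → f (i , a) * (G j * A i j))))
    ≡⟨ ∑ℕ-cong s (λ i → ∑ℕ-comm (n i) s _) ⟩
  ∑ℕ s (λ i → ∑ℕ s (λ j → ∑ℕ (n i) (λ a → f (i , a) * (G j * A i j))))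
    ≡⟨ ∑ℕ-cong s (λ i → ∑ℕ-cong s (λ j → sym (*-distribʳ-∑ℕ (n i) _ _))) ⟩
  ∑ℕ s (λ i → ∑ℕ s (λ j → F i * (G j * A i j))) ∎
  where
  A : Fin s → Fin s → ℕ
  A i j = ⟦ not ⌊ i ≟ j ⌋ ⟧
  F G : Fin s → ℕ
  F i = ∑ℕ (n i) (λ a → f (i , a))
  G j = ∑ℕ (n j) (λ b → g (j , b))
  pull-out : ∀ x j w → ∑ℕ (n j) (λ b → x * (g (j , b) * w)) ≡ x * (G j * w)
  pull-out x j w = begin
    ∑ℕ (n j) (λ b → x * (g (j , b) * w)) ≡⟨ sym (*-distribˡ-∑ℕ (n j) x _) ⟩
    x * ∑ℕ (n j) (λ b → g (j , b) * w)   ≡⟨ cong (x *_) (sym (*-distribʳ-∑ℕ (n j) w _)) ⟩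
    x * (G j * w)                        ∎

+-sub-sub : ∀ {a b c t} → a + b + c ≡ t → + a ≡ + t ℤ.- + c ℤ.- + b
+-sub-sub {a} {b} {c} refl = begin
  + a                                             ≡⟨ cancel (+ a) (+ b) (+ c) ⟩
  (+ a ℤ.+ + b) ℤ.+ + c ℤ.- + c ℤ.- + b           ≡⟨ cong (λ t → t ℤ.- + c ℤ.- + b) (sym (+-homo a b c)) ⟩
  + (a + b + c) ℤ.- + c ℤ.- + b                   ∎
  where
  cancel : ∀ (A B C : ℤ) → A ≡ (A ℤ.+ B) ℤ.+ C ℤ.- C ℤ.- B
  cancel = solve-∀
  +-homo : ∀ a b c → + (a + b + c) ≡ (+ a ℤ.+ + b) ℤ.+ + c
  +-homo a b c = trans (pos-+ (a + b) c) (cong (ℤ._+ + c) (pos-+ a b))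

module Contraction (s : ℕ) (n : Fin s → ℕ) (c : ℕ) (comp : Vtx s n → Fin c) where

  column : Fin c → Fin s → ℕ
  column p i = Nmat s n c comp i p

  crossEdges : Fin c → Fin c → ℕ
  crossEdges p q = ∑V s n (λ u → ∑V s n (λ v → ⟦ ⌊ comp u ≟ p ⌋ ∧ ⌊ comp v ≟ q ⌋ ∧ adjᵇ u v ⟧))

  crossEdges≡adjacencyForm : ∀ p q → crossEdges p q ≡ adjacencyForm (column p) (column q)
  crossEdges≡adjacencyForm p q = trans
    (∑V-cong s n (λ u → ∑V-cong s n (λ v →
      trans (⟦∧⟧ ⌊ comp u ≟ p ⌋ _) (cong (⟦ ⌊ comp u ≟ p ⌋ ⟧ *_) (⟦∧⟧ ⌊ comp v ≟ q ⌋ _)))))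
    (∑V²-adjacencyForm s n (λ u → ⟦ ⌊ comp u ≟ p ⌋ ⟧) (λ v → ⟦ ⌊ comp v ≟ q ⌋ ⟧))

  ∑-Nmat : ∀ i → ∑ℕ c (λ r → Nmat s n c comp i r) ≡ n i
  ∑-Nmat i = begin
    ∑ℕ c (λ r → ∑ℕ (n i) (λ a → ⟦ ⌊ comp (i , a) ≟ r ⌋ ⟧))
      ≡⟨ ∑ℕ-comm c (n i) _ ⟩
    ∑ℕ (n i) (λ a → ∑ℕ c (λ r → ⟦ ⌊ comp (i , a) ≟ r ⌋ ⟧))
      ≡⟨ ∑ℕ-cong (n i) (λ a → ∑ℕ-select (comp (i , a)) (λ _ → 1)) ⟩
    ∑ℕ (n i) (λ _ → 1)
      ≡⟨ trans (∑ℕ-const (n i) 1) (*-identityʳ (n i)) ⟩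
    n i ∎

  degree-identity : ∀ p → ∑ℕ c (contractMult s n c comp p) + crossEdges p p + ∑ℕ s (λ i → n i * column p i)
                 ≡ ∑ℕ s n * compSize s n c comp p
  degree-identity p = begin
    ∑ℕ c (contractMult s n c comp p) + crossEdges p p + ∑ℕ s (λ i → n i * column p i)
      ≡⟨ cong₂ _+_ (∑ℕ-punctured p (crossEdges p)) (∑ℕ-cong s (λ i → *-comm (n i) _)) ⟩
    ∑ℕ c (crossEdges p) + ∑ℕ s (λ i → column p i * n i)
      ≡⟨ cong (_+ ∑ℕ s (λ i → column p i * n i))
              (trans (∑ℕ-cong c (crossEdges≡adjacencyForm p)) (∑-adjacencyFormʳ (column p) column n ∑-Nmat)) ⟩
    adjacencyForm (column p) n + ∑ℕ s (λ i → column p i * n i)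
      ≡⟨ adjacencyForm-+-dot (column p) n ⟩
    compSize s n c comp p * ∑ℕ s n
      ≡⟨ *-comm _ (∑ℕ s n) ⟩
    ∑ℕ s n * compSize s n c comp p ∎

  NᵀIJN : Fin c → Fin c → ℤ
  NᵀIJN p q = ∑ℤ s (λ i → ∑ℤ s (λ j → + column p i ℤ.* IminusJ s i j ℤ.* + column q j))

  laplacian≡rhsMatrix : ∀ p q → Laplacian c (contractMult s n c comp) p q ≡ rhsMatrix s n c comp p q
  laplacian≡rhsMatrix p q with p ≟ q
  ... | yes refl = begin
    + ∑ℕ c (contractMult s n c comp p)
      ≡⟨ +-sub-sub (degree-identity p) ⟩
    alpha s n c comp p ℤ.- + crossEdges p p
      ≡⟨ cong (λ e → alpha s n c comp p ℤ.- + e) (crossEdges≡adjacencyForm p p) ⟩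
    alpha s n c comp p ℤ.- + adjacencyForm (column p) (column p)
      ≡⟨ cong (ℤ._+_ (alpha s n c comp p)) (sym (adjacencyForm-ℤ (column p) (column p))) ⟩
    alpha s n c comp p ℤ.+ NᵀIJN p p ∎
  ... | no _ = begin
    - (+ crossEdges p q)                      ≡⟨ cong (λ e → - (+ e)) (crossEdges≡adjacencyForm p q) ⟩
    - (+ adjacencyForm (column p) (column q)) ≡⟨ sym (adjacencyForm-ℤ (column p) (column q)) ⟩
    NᵀIJN p q                                 ≡⟨ sym (+-identityˡ (NᵀIJN p q)) ⟩
    + 0 ℤ.+ NᵀIJN p q                         ∎

-- Only the partition into classes Components.comp is used: the identity holds for
-- any map from the vertices to Fin c.
proposition3p2 : (s : ℕ) → 2 ≤ s → (n : Fin s → ℕ) → (∀ i → 1 ≤ n i) →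
    (F : Vtx s n → Vtx s n → Set) → SpanningForest s n F →
    (c : ℕ) (T : Components F c) →
    ∀ p q → Laplacian c (contractMult s n c (Components.comp T)) p q
            ≡ rhsMatrix s n c (Components.comp T) p q
proposition3p2 s _ n _ F _ c T = Contraction.laplacian≡rhsMatrix s n c (Components.comp T)
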